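{- Consider the Zeckendorf game on $n$ with $p$ players and let $A$ be an alliance (set of players) containing more than two-thirds of the players. Suppose there is an integer $b$ such that whenever player $i$ is not in $A$, player $(i-b) \bmod p$ is in $A$, and suppose $A$ contains at least $2b$ cyclically consecutive players. If $n \geq 4pb+2p-2b$, then $A$ has a winning strategy.
   Context: Let $F_1=1$, $F_2=2$, $F_{i+1}=F_i+F_{i-1}$. The Zeckendorf game on $n$ starts with the multiset of $n$ copies of $1$. A move is one of: if the list contains $F_{i-1}$ and $F_i$, replace them by $F_{i+1}$; if the list contains two copies of $F_i$: for $i=1$ replace them by $F_2$; for $i=2$ replace them by $F_1,F_3$; for $i\geq 3$ replace them by $F_{i-2},F_{i+1}$. The game ends when the list is the Zeckendorf decomposition of $n$ (distinct, pairwise non-consecutive Fibonacci numbers); every game terminates. With $p$ players, players $1,\dots,p$ (indices taken mod $p$) move in cyclic order $1,2,\dots,p,1,2,\dots$ starting with player 1; players $i$ and $i+1 \pmod p$ are consecutive. An alliance wins if the final move (creating the Zeckendorf decomposition) is made by one of its members; it has a winning strategy if its members can choose their moves so that the final move is made by a member no matter what moves the other players make. -}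

module Defs where

open import Data.Nat using (ℕ; zero; suc; _+_; _*_; _∸_; _≤_; _<_; NonZero)
open import Data.Nat.DivMod using (_%_; m%n<n)
open import Data.Fin using (Fin; fromℕ<)
open import Data.Fin.Subset using (Subset; _∈_; _∉_)
open import Data.Product using (_×_)
open import Data.Sum using (_⊎_)
open import Relation.Nullary using (¬_)
open import Relation.Binary.PropositionalEquality using (_≡_)

-- Fibonacci numbers of the paper: F 1 = 1, F 2 = 2, F (i+1) = F i + F (i-1).
-- Here fib k = F_(k+1), i.e. fib 0 = 1, fib 1 = 2, fib 2 = 3, ...
fib : ℕ → ℕ
fib 0 = 1
fib 1 = 2
fib (suc (suc k)) = fib (suc k) + fib k

-- A game state (a multiset of Fibonacci numbers) is given by its multiplicity
-- function: c k = number of copies of F_(k+1) = fib k in the list.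
State : Set
State = ℕ → ℕ

bump : ℕ → State → State
bump k c j with j Data.Nat.≟ k
... | Relation.Nullary.yes _ = suc (c j)
... | Relation.Nullary.no _ = c j

drop : ℕ → State → State
drop k c j with j Data.Nat.≟ k
... | Relation.Nullary.yes _ = c j ∸ 1
... | Relation.Nullary.no _ = c j

start : ℕ → State
start n zero = n
start n (suc _) = 0

data Move (c : State) : State → Set where
  -- F_(k+1), F_(k+2)  ↦  F_(k+3)   (i.e. F_(i-1), F_i ↦ F_(i+1))
  combine : ∀ k → 1 ≤ c k → 1 ≤ c (suc k) →
            Move c (bump (suc (suc k)) (drop (suc k) (drop k c)))
  -- 2 F_1 ↦ F_2
  split1  : 2 ≤ c 0 → Move c (bump 1 (drop 0 (drop 0 c)))
  -- 2 F_2 ↦ F_1, F_3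
  split2  : 2 ≤ c 1 → Move c (bump 2 (bump 0 (drop 1 (drop 1 c))))
  -- 2 F_i ↦ F_(i-2), F_(i+1)  for i ≥ 3  (here i = m + 3)
  splitHi : ∀ m → 2 ≤ c (suc (suc m)) →
            Move c (bump (suc (suc (suc m))) (bump m (drop (suc (suc m)) (drop (suc (suc m)) c))))

-- The list is a Zeckendorf decomposition: distinct, pairwise non-consecutive
-- Fibonacci numbers.  (The sum of the list is invariant under moves, so along
-- a game on n this is exactly "the list is the Zeckendorf decomposition of n".)
IsZeck : State → Set
IsZeck c = (∀ k → c k ≤ 1) × (∀ k → c k + c (suc k) ≤ 1)

-- Players 1..p are represented by Fin p (player i+1 ↦ index i).  Move number t
-- (t = 0,1,2,...) is made by player (t mod p) + 1.  An alliance is a subset of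
-- the players; InA A t : the player with index (t mod p) belongs to A.
InA : (p : ℕ) .{{_ : NonZero p}} → Subset p → ℕ → Set
InA p A t = fromℕ< (m%n<n t p) ∈ A

-- Since every game terminates, this inductive (least
-- fixed point) definition is exactly the existence of a winning strategy.
data Wins (p : ℕ) .{{_ : NonZero p}} (A : Subset p) : ℕ → State → Set where
  ally : ∀ {t c} c' → InA p A t → Move c c' →
         (IsZeck c' ⊎ (¬ IsZeck c' × Wins p A (suc t) c')) → Wins p A t c
  foe  : ∀ {t c} → ¬ InA p A t →
         (∀ c' → Move c c' → ¬ IsZeck c' × Wins p A (suc t) c') → Wins p A t c

HasWinningStrategy : (p : ℕ) .{{_ : NonZero p}} → Subset p → ℕ → Set
HasWinningStrategy p A n = Wins p A 0 (start n)

-- Every move strictly increases the potential Σ c_k 3^k of a position, which stays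
-- below 3^n n, so the game is finite and therefore determined: for every alliance B,
-- either B or its complement can force the last move.
--
-- A's strategy: during s mod p turns and then b full rounds of p turns, A always
-- merges two 1s into a 2.  A move removes at most two pieces from each pile, and A
-- owns more than two thirds of every round, so when A's block of 2b consecutive
-- turns begins there are still at least b + 2 ones and b twos.  From there A can
-- reach one and the same position P either in b moves (1 + 2 → 3, b times) or in
-- 2b moves ((1 + 1 → 2, 2 + 2 → 1 + 3), b times).  If A wins from P with the
-- (b+1)-st block turn to move, it takes the short route.  Otherwise the complement
-- of A wins from P at that time, and A takes the long route and copies that
-- strategy with a delay of b turns; by the hypothesis on b, turn t + b belongs to A
-- whenever turn t does not.

module Submission where

open import Defs
open import Data.Nat
open import Data.Nat.Properties
open import Data.List using (List; []; _∷_; foldr; map; length)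
open import Data.Nat.ListAction using (sum)
open import Data.List.Relation.Unary.All as All using (All; []; _∷_)
open import Data.List.Membership.Propositional using (_∈_)
open import Data.List.Relation.Unary.Any using (here; there)
open import Data.Product using (Σ; Σ-syntax; ∃; _×_; _,_; proj₁; proj₂)
open import Data.Sum as Sum using (_⊎_; inj₁; inj₂; [_,_]′)
open import Data.Unit using (⊤; tt)
open import Function using (_∘_)
open import Data.Bool.Properties using (not-involutive)
open import Data.Vec using (_∷_; []; here; there)
open import Data.Fin using (Fin; zero; fromℕ<)
open import Data.Fin.Subset using (Subset; ∁; inside; outside; ∣_∣) renaming (_∈_ to _∈ₛ_)
open import Data.Fin.Subset.Properties using (_∈?_; x∈p⇒x∉∁p; x∉p⇒x∈∁p; x∈∁p⇒x∉p)
open import Data.Nat.DivMod using (_%_; m%n<n; [m+n]%n≡m%n; [m+kn]%n≡m%n; m<n⇒m%n≡m; m%n%n≡m%n; %-distribˡ-+)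
open import Data.Fin.Properties using (fromℕ<-cong)
open import Relation.Nullary using (¬_; Dec; yes; no; contradiction; _×-dec_)
open import Relation.Binary.PropositionalEquality
open import Data.Nat.Tactic.RingSolver using (solve-∀)
open import Algebra.Properties.CommutativeSemigroup +-commutativeSemigroup using (xy∙z≈xz∙y; xy∙z≈x∙zy; x∙yz≈xz∙y; x∙yz≈y∙xz)
open import Data.Nat.GeneralisedArithmetic using (iterate)

private variable
  c c' d : State
  i k N : ℕ

-- Adding and removing pieces

bump-≡ : ∀ k c → bump k c k ≡ suc (c k)
bump-≡ k c with k ≟ k
... | yes _ = refl
... | no k≢k = contradiction refl k≢k

bump-≢ : ∀ k c → i ≢ k → bump k c i ≡ c i
bump-≢ {i} k c i≢k with i ≟ k
... | yes i≡k = contradiction i≡k i≢k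
... | no _ = refl

drop-≤ : ∀ k c i → drop k c i ≤ c i
drop-≤ k c i with i ≟ k
... | yes _ = m∸n≤m (c i) 1
... | no _ = ≤-refl

drop-≡ : ∀ k c → drop k c k ≡ c k ∸ 1
drop-≡ k c with k ≟ k
... | yes _ = refl
... | no k≢k = contradiction refl k≢k

drop-≢ : ∀ k c → i ≢ k → drop k c i ≡ c i
drop-≢ {i} k c i≢k with i ≟ k
... | yes i≡k = contradiction i≡k i≢k
... | no _ = refl

bump-drop : ∀ k c → 1 ≤ c k → bump k (drop k c) ≗ c
bump-drop k c 1≤ck i = by-cases (i ≟ k)
  where
  by-cases : Dec (i ≡ k) → bump k (drop k c) i ≡ c i
  by-cases (yes refl) = begin
    bump i (drop i c) i ≡⟨ bump-≡ i (drop i c) ⟩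
    suc (drop i c i)    ≡⟨ cong suc (drop-≡ i c) ⟩
    suc (c i ∸ 1)       ≡⟨ +-comm 1 (c i ∸ 1) ⟩
    c i ∸ 1 + 1         ≡⟨ m∸n+n≡m 1≤ck ⟩
    c i                 ∎
    where open ≡-Reasoning
  by-cases (no i≢k) = trans (bump-≢ k (drop k c) i≢k) (drop-≢ k c i≢k)

bump-≥ : ∀ k c j → c j ≤ bump k c j
bump-≥ k c j with j ≟ k
... | yes _ = n≤1+n (c j)
... | no _  = ≤-refl

drop-≥ : ∀ k c j → c j ≤ suc (drop k c j)
drop-≥ k c j with j ≟ k
... | yes _ = m≤n+m∸n (c j) 1
... | no _  = n≤1+n (c j)

bump-cong : ∀ k → c ≗ d → bump k c ≗ bump k d
bump-cong k c≗d j with j ≟ k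
... | yes _ = cong suc (c≗d j)
... | no _  = c≗d j

drop-cong : ∀ k → c ≗ d → drop k c ≗ drop k d
drop-cong k c≗d j with j ≟ k
... | yes _ = cong (_∸ 1) (c≗d j)
... | no _  = c≗d j

bumps drops : List ℕ → State → State
bumps is c = foldr bump c is
drops is c = foldr drop c is

listWeight : (ℕ → ℕ) → List ℕ → ℕ
listWeight w is = sum (map w is)

Removable : List ℕ → State → Set
Removable []       c = ⊤
Removable (i ∷ is) c = 1 ≤ drops is c i × Removable is c

bumps-≥ : ∀ is c j → c j ≤ bumps is c j
bumps-≥ []       c j = ≤-refl
bumps-≥ (i ∷ is) c j = ≤-trans (bumps-≥ is c j) (bump-≥ i (bumps is c) j)

drops-≥ : ∀ is c j → c j ≤ length is + drops is c j
drops-≥ []       c j = ≤-refl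
drops-≥ (i ∷ is) c j = begin
  c j                                  ≤⟨ drops-≥ is c j ⟩
  length is + drops is c j             ≤⟨ +-monoʳ-≤ (length is) (drop-≥ i (drops is c) j) ⟩
  length is + suc (drops (i ∷ is) c j) ≡⟨ +-suc (length is) _ ⟩
  length (i ∷ is) + drops (i ∷ is) c j ∎
  where open ≤-Reasoning

bumps-cong : ∀ is → c ≗ d → bumps is c ≗ bumps is d
bumps-cong []       c≗d = c≗d
bumps-cong (i ∷ is) c≗d = bump-cong i (bumps-cong is c≗d)

drops-cong : ∀ is → c ≗ d → drops is c ≗ drops is d
drops-cong []       c≗d = c≗d
drops-cong (i ∷ is) c≗d = drop-cong i (drops-cong is c≗d)

-- Weighted totals

total : (ℕ → ℕ) → ℕ → State → ℕ
total w zero    c = 0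
total w (suc N) c = total w N c + c N * w N

total-cong : ∀ w N → (∀ j → j < N → c j ≡ d j) → total w N c ≡ total w N d
total-cong w zero    c≡d = refl
total-cong w (suc N) c≡d =
  cong₂ _+_ (total-cong w N (λ j j<N → c≡d j (m<n⇒m<1+n j<N))) (cong (_* w N) (c≡d N ≤-refl))

total-bump : ∀ w N k c → k < N → total w N (bump k c) ≡ total w N c + w k
total-bump w (suc N) k c k<1+N with m<1+n⇒m<n∨m≡n k<1+N
... | inj₁ k<N = begin
  total w N (bump k c) + bump k c N * w N ≡⟨ cong₂ _+_ (total-bump w N k c k<N) (cong (_* w N) (bump-≢ k c (>⇒≢ k<N))) ⟩
  total w N c + w k + c N * w N           ≡⟨ xy∙z≈xz∙y (total w N c) (w k) _ ⟩
  total w N c + c N * w N + w k           ∎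
  where open ≡-Reasoning
... | inj₂ refl = begin
  total w k (bump k c) + bump k c k * w k ≡⟨ cong₂ _+_ (total-cong w k (λ j j<k → bump-≢ k c (<⇒≢ j<k))) (cong (_* w k) (bump-≡ k c)) ⟩
  total w k c + (w k + c k * w k)         ≡⟨ x∙yz≈xz∙y (total w k c) (w k) _ ⟩
  total w k c + c k * w k + w k           ∎
  where open ≡-Reasoning

total-drop : ∀ w N k c → k < N → 1 ≤ c k → total w N c ≡ total w N (drop k c) + w k
total-drop w N k c k<N 1≤ck =
  trans (total-cong w N (λ j _ → sym (bump-drop k c 1≤ck j))) (total-bump w N k (drop k c) k<N)

total-dominated : ∀ {v w} m N c → (∀ j → j < N → v j ≤ m * w j) → total v N c ≤ m * total w N c
total-dominated m zero    c v≤mw = z≤n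
total-dominated {v} {w} m (suc N) c v≤mw = begin
  total v N c + c N * v N               ≤⟨ +-mono-≤ (total-dominated m N c (λ j j<N → v≤mw j (m<n⇒m<1+n j<N)))
                                                    (*-monoʳ-≤ (c N) (v≤mw N ≤-refl)) ⟩
  m * total w N c + c N * (m * w N)     ≡⟨ rearrange m (total w N c) (c N) (w N) ⟩
  m * (total w N c + c N * w N)         ∎
  where
  open ≤-Reasoning
  rearrange : ∀ m t a x → m * t + a * (m * x) ≡ m * (t + a * x)
  rearrange = solve-∀

SupportBelow : ℕ → State → Set
SupportBelow N c = ∀ j → N ≤ j → c j ≡ 0

support-bound : SupportBelow N c → 1 ≤ c k → k < N
support-bound {N} {c} {k} supp 1≤ck with N ≤? k
... | yes N≤k = contradiction (supp k N≤k) (>⇒≢ 1≤ck)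
... | no N≰k = ≰⇒> N≰k

bump-support : SupportBelow N c → k < N → SupportBelow N (bump k c)
bump-support {N} {c} {k} supp k<N j N≤j =
  trans (bump-≢ k c (λ j≡k → <⇒≱ k<N (subst (N ≤_) j≡k N≤j))) (supp j N≤j)

drop-support : SupportBelow N c → SupportBelow N (drop k c)
drop-support {c = c} {k} supp j N≤j = n≤0⇒n≡0 (subst (drop k c j ≤_) (supp j N≤j) (drop-≤ k c j))

bumps-support : ∀ is → All (_< N) is → SupportBelow N c → SupportBelow N (bumps is c)
bumps-support []       []           supp = supp
bumps-support (i ∷ is) (i<N ∷ is<N) supp = bump-support (bumps-support is is<N supp) i<N

drops-support : ∀ is → SupportBelow N c → SupportBelow N (drops is c)
drops-support []       supp = supp
drops-support (i ∷ is) supp = drop-support (drops-support is supp)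

total-bumps : ∀ w N is c → All (_< N) is → total w N (bumps is c) ≡ total w N c + listWeight w is
total-bumps w N []       c []           = sym (+-identityʳ (total w N c))
total-bumps w N (i ∷ is) c (i<N ∷ is<N) = begin
  total w N (bump i (bumps is c))      ≡⟨ total-bump w N i (bumps is c) i<N ⟩
  total w N (bumps is c) + w i         ≡⟨ cong (_+ w i) (total-bumps w N is c is<N) ⟩
  total w N c + listWeight w is + w i  ≡⟨ xy∙z≈x∙zy (total w N c) _ (w i) ⟩
  total w N c + listWeight w (i ∷ is)  ∎
  where open ≡-Reasoning

total-drops : ∀ w N is c → SupportBelow N c → Removable is c →
              total w N c ≡ total w N (drops is c) + listWeight w is
total-drops w N []       c supp tt = sym (+-identityʳ (total w N c))
total-drops w N (i ∷ is) c supp (1≤i , rest) = begin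
  total w N c                                       ≡⟨ total-drops w N is c supp rest ⟩
  total w N (drops is c) + listWeight w is          ≡⟨ cong (_+ listWeight w is) (total-drop w N i (drops is c) i<N 1≤i) ⟩
  total w N (drops (i ∷ is) c) + w i + listWeight w is ≡⟨ +-assoc (total w N (drops (i ∷ is) c)) (w i) _ ⟩
  total w N (drops (i ∷ is) c) + listWeight w (i ∷ is) ∎
  where
  open ≡-Reasoning
  i<N : i < N
  i<N = support-bound (drops-support is supp) 1≤i

-- The effect of a move

consumed produced : Move c c' → List ℕ
consumed (combine k _ _) = suc k ∷ k ∷ []
consumed (split1 _)      = 0 ∷ 0 ∷ []
consumed (split2 _)      = 1 ∷ 1 ∷ []
consumed (splitHi m _)   = suc (suc m) ∷ suc (suc m) ∷ []
produced (combine k _ _) = suc (suc k) ∷ []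
produced (split1 _)      = 1 ∷ []
produced (split2 _)      = 2 ∷ 0 ∷ []
produced (splitHi m _)   = suc (suc (suc m)) ∷ m ∷ []

move-target : (mv : Move c c') → c' ≡ bumps (produced mv) (drops (consumed mv) c)
move-target (combine _ _ _) = refl
move-target (split1 _)      = refl
move-target (split2 _)      = refl
move-target (splitHi _ _)   = refl

twice-removable : ∀ k c → 2 ≤ c k → Removable (k ∷ k ∷ []) c
twice-removable k c 2≤ck = subst (1 ≤_) (sym (drop-≡ k c)) (∸-monoˡ-≤ 1 2≤ck) , ≤-trans (s≤s z≤n) 2≤ck , tt

consumed-removable : (mv : Move c c') → Removable (consumed mv) c
consumed-removable {c} (combine k 1≤ck 1≤ck+1) = subst (1 ≤_) (sym (drop-≢ k c 1+n≢n)) 1≤ck+1 , 1≤ck , tt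
consumed-removable {c} (split1 2≤c0)    = twice-removable 0 c 2≤c0
consumed-removable {c} (split2 2≤c1)    = twice-removable 1 c 2≤c1
consumed-removable {c} (splitHi m 2≤ck) = twice-removable (suc (suc m)) c 2≤ck

fib-balanced : (mv : Move c c') → listWeight fib (consumed mv) ≡ listWeight fib (produced mv)
fib-balanced (combine k _ _) = combine-identity (fib k) (fib (suc k))
  where
  combine-identity : ∀ a b → b + (a + 0) ≡ b + a + 0
  combine-identity = solve-∀
fib-balanced (split1 _) = refl
fib-balanced (split2 _) = refl
fib-balanced (splitHi m _) = split-identity (fib m) (fib (suc m))
  where
  split-identity : ∀ a b → b + a + (b + a + 0) ≡ b + a + b + (a + 0)
  split-identity = solve-∀

scale-< : ∀ k {a b} → a < b → a * 3 ^ k < b * 3 ^ k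
scale-< k = *-monoˡ-< (3 ^ k) {{m^n≢0 3 k}}

potential-grows : (mv : Move c c') → listWeight (3 ^_) (consumed mv) < listWeight (3 ^_) (produced mv)
potential-grows (combine k _ _) =
  subst₂ _<_ (lhs (3 ^ k)) (rhs (3 ^ k)) (scale-< k (m<m+n 4 {5} z<s))
  where
  lhs : ∀ x → 4 * x ≡ 3 * x + (x + 0)
  lhs = solve-∀
  rhs : ∀ x → 9 * x ≡ 3 * (3 * x) + 0
  rhs = solve-∀
potential-grows (split1 _) = m<m+n 2 {1} z<s
potential-grows (split2 _) = m<m+n 6 {4} z<s
potential-grows (splitHi m _) =
  subst₂ _<_ (lhs (3 ^ m)) (rhs (3 ^ m)) (scale-< m (m<m+n 18 {10} z<s))
  where
  lhs : ∀ x → 18 * x ≡ 3 * (3 * x) + (3 * (3 * x) + 0)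
  lhs = solve-∀
  rhs : ∀ x → 28 * x ≡ 3 * (3 * (3 * x)) + (x + 0)
  rhs = solve-∀

consumed-length : (mv : Move c c') → length (consumed mv) ≡ 2
consumed-length (combine _ _ _) = refl
consumed-length (split1 _)      = refl
consumed-length (split2 _)      = refl
consumed-length (splitHi _ _)   = refl

move-loss : Move c c' → ∀ j → c j ≤ 2 + c' j
move-loss {c} mv j = subst (λ d → c j ≤ 2 + d j) (sym (move-target mv)) (begin
  c j                                               ≤⟨ drops-≥ (consumed mv) c j ⟩
  length (consumed mv) + drops (consumed mv) c j    ≡⟨ cong (_+ drops (consumed mv) c j) (consumed-length mv) ⟩
  2 + drops (consumed mv) c j                       ≤⟨ +-monoʳ-≤ 2 (bumps-≥ (produced mv) _ j) ⟩
  2 + bumps (produced mv) (drops (consumed mv) c) j ∎)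
  where open ≤-Reasoning

move-cong : c ≗ d → (mv : Move c c') → Σ[ d' ∈ State ] Move d d' × c' ≗ d'
move-cong {c} {d} c≗d mv = _ , transported mv , targets≗
  where
  at : ∀ k {m} → m ≤ c k → m ≤ d k
  at k = subst (_ ≤_) (c≗d k)
  transported : (mv : Move c c') → Move d (bumps (produced mv) (drops (consumed mv) d))
  transported (combine k h h') = combine k (at k h) (at (suc k) h')
  transported (split1 h)       = split1 (at 0 h)
  transported (split2 h)       = split2 (at 1 h)
  transported (splitHi m h)    = splitHi m (at (suc (suc m)) h)
  targets≗ : _ ≗ bumps (produced mv) (drops (consumed mv) d)
  targets≗ j = trans (cong (λ e → e j) (move-target mv)) (bumps-cong (produced mv) (drops-cong (consumed mv) c≗d) j)

zeck-cong : c ≗ d → IsZeck c → IsZeck d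
zeck-cong c≗d (single , adjacent) =
  (λ k → subst (_≤ 1) (c≗d k) (single k)) , (λ k → subst₂ (λ x y → x + y ≤ 1) (c≗d k) (c≗d (suc k)) (adjacent k))

-- Positions and the potential

∈⇒≤listWeight : ∀ w {is} → i ∈ is → w i ≤ listWeight w is
∈⇒≤listWeight w {j ∷ is} (here refl) = m≤m+n (w j) (listWeight w is)
∈⇒≤listWeight w {j ∷ is} (there i∈is) = ≤-trans (∈⇒≤listWeight w i∈is) (m≤n+m _ (w j))

fib-> : ∀ j → j < fib j
fib-> zero          = z<s
fib-> (suc zero)    = s<s z<s
fib-> (suc (suc j)) =
  subst (suc (suc j) <_) (+-comm (fib j) (fib (suc j))) (+-mono-≤-< (≤-<-trans z≤n (fib-> j)) (fib-> (suc j)))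

IsPosition : ℕ → State → Set
IsPosition n c = SupportBelow n c × total fib n c ≡ n

potential : ℕ → State → ℕ
potential n = total (3 ^_) n

start-position : ∀ n → IsPosition n (start n)
start-position n = support , total-start n
  where
  support : SupportBelow n (start n)
  support zero    n≤0 = n≤0⇒n≡0 n≤0
  support (suc j) _   = refl
  total-start-above : ∀ N x → total fib (suc N) (start x) ≡ x
  total-start-above zero    x = *-identityʳ x
  total-start-above (suc N) x = trans (+-identityʳ _) (total-start-above N x)
  total-start : ∀ n → total fib n (start n) ≡ n
  total-start zero    = refl
  total-start (suc N) = total-start-above N (suc N)

potential-bound : ∀ n → IsPosition n c → potential n c ≤ 3 ^ n * n
potential-bound {c} n (supp , total≡n) = begin
  potential n c       ≤⟨ total-dominated (3 ^ n) n c 3^j≤3^n*fib ⟩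
  3 ^ n * total fib n c ≡⟨ cong (3 ^ n *_) total≡n ⟩
  3 ^ n * n           ∎
  where
  open ≤-Reasoning
  3^j≤3^n*fib : ∀ j → j < n → 3 ^ j ≤ 3 ^ n * fib j
  3^j≤3^n*fib j j<n =
    ≤-trans (^-monoʳ-≤ 3 (<⇒≤ j<n)) (m≤m*n (3 ^ n) (fib j) {{>-nonZero (≤-<-trans z≤n (fib-> j))}})

module _ {n} (pos : IsPosition n c) (mv : Move c c') where
  private
    mid : State
    mid = drops (consumed mv) c

    total-before : ∀ w → total w n c ≡ total w n mid + listWeight w (consumed mv)
    total-before w = total-drops w n (consumed mv) c (proj₁ pos) (consumed-removable mv)

    produced-below : All (_< n) (produced mv)
    produced-below = All.tabulate λ {i} i∈ → <-≤-trans (fib-> i) (begin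
      fib i                              ≤⟨ ∈⇒≤listWeight fib i∈ ⟩
      listWeight fib (produced mv)       ≡⟨ fib-balanced mv ⟨
      listWeight fib (consumed mv)       ≤⟨ m≤n+m _ (total fib n mid) ⟩
      total fib n mid + listWeight fib (consumed mv) ≡⟨ total-before fib ⟨
      total fib n c                      ≡⟨ proj₂ pos ⟩
      n                                  ∎)
      where open ≤-Reasoning

    total-after : ∀ w → total w n c' ≡ total w n mid + listWeight w (produced mv)
    total-after w = subst (λ d → total w n d ≡ total w n mid + listWeight w (produced mv)) (sym (move-target mv)) (total-bumps w n (produced mv) mid produced-below)

  move-position : IsPosition n c'
  move-position = support , total≡n
    where
    support : SupportBelow n c'
    support = subst (SupportBelow n) (sym (move-target mv))
                (bumps-support (produced mv) produced-below (drops-support (consumed mv) (proj₁ pos)))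
    total≡n : total fib n c' ≡ n
    total≡n = begin
      total fib n c'                                ≡⟨ total-after fib ⟩
      total fib n mid + listWeight fib (produced mv) ≡⟨ cong (total fib n mid +_) (fib-balanced mv) ⟨
      total fib n mid + listWeight fib (consumed mv) ≡⟨ total-before fib ⟨
      total fib n c                                 ≡⟨ proj₂ pos ⟩
      n                                             ∎
      where open ≡-Reasoning

  move-potential : potential n c < potential n c'
  move-potential = begin-strict
    potential n c                                    ≡⟨ total-before (3 ^_) ⟩
    total (3 ^_) n mid + listWeight (3 ^_) (consumed mv) <⟨ +-monoʳ-< (total (3 ^_) n mid) (potential-grows mv) ⟩
    total (3 ^_) n mid + listWeight (3 ^_) (produced mv) ≡⟨ total-after (3 ^_) ⟨
    potential n c'                                   ∎
    where open ≤-Reasoning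

-- Finding moves

splitTarget : ℕ → State → State
splitTarget zero                c = bump 1 (drop 0 (drop 0 c))
splitTarget (suc zero)          c = bump 2 (bump 0 (drop 1 (drop 1 c)))
splitTarget (suc (suc m))       c = bump (suc (suc (suc m))) (bump m (drop (suc (suc m)) (drop (suc (suc m)) c)))

split : ∀ k → 2 ≤ c k → Move c (splitTarget k c)
split zero          = split1
split (suc zero)    = split2
split (suc (suc m)) = splitHi m

witness-or-all< : ∀ {X : Set} {Q : ℕ → Set} N → (∀ k → X ⊎ Q k) → X ⊎ (∀ k → k < N → Q k)
witness-or-all< zero    decide = inj₂ λ k ()
witness-or-all< (suc N) decide with witness-or-all< N decide | decide N
... | inj₁ x     | _        = inj₁ x
... | inj₂ _     | inj₁ x   = inj₁ x
... | inj₂ below | inj₂ q-N = inj₂ λ k k<1+N → [ below k , (λ { refl → q-N }) ]′ (m<1+n⇒m<n∨m≡n k<1+N)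

ZeckAt : State → ℕ → Set
ZeckAt c k = c k ≤ 1 × c k + c (suc k) ≤ 1

move-or-zeckAt : ∀ c k → Σ State (Move c) ⊎ ZeckAt c k
move-or-zeckAt c k with c k ≤? 1 | c k + c (suc k) ≤? 1
... | no ck≰1  | _          = inj₁ (_ , split k (≰⇒> ck≰1))
... | yes ck≤1 | yes pair≤1 = inj₂ (ck≤1 , pair≤1)
... | yes ck≤1 | no pair≰1  = inj₁ (adjacent (m≤n⇒m<n∨m≡n ck≤1))
  where
  2≤pair : 2 ≤ c k + c (suc k)
  2≤pair = ≰⇒> pair≰1
  adjacent : c k < 1 ⊎ c k ≡ 1 → Σ State (Move c)
  adjacent (inj₁ ck<1) = _ , split (suc k) (subst (λ x → 2 ≤ x + c (suc k)) (n<1⇒n≡0 ck<1) 2≤pair)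
  adjacent (inj₂ ck≡1) = _ , combine k (≤-reflexive (sym ck≡1)) (s≤s⁻¹ (subst (λ x → 2 ≤ x + c (suc k)) ck≡1 2≤pair))

zeck-or-move : SupportBelow N c → IsZeck c ⊎ Σ State (Move c)
zeck-or-move {N} {c} supp with witness-or-all< N (move-or-zeckAt c)
... | inj₁ mv    = inj₂ mv
... | inj₂ below = inj₁ (proj₁ ∘ zeckAt , proj₂ ∘ zeckAt)
  where
  zeckAt : ∀ k → ZeckAt c k
  zeckAt k with k <? N
  ... | yes k<N = below k k<N
  ... | no k≮N rewrite supp k (≮⇒≥ k≮N) | supp (suc k) (m≤n⇒m≤1+n (≮⇒≥ k≮N)) = z≤n , z≤n

2≤⇒¬IsZeck : ∀ k → 2 ≤ c k → ¬ IsZeck c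
2≤⇒¬IsZeck k 2≤ck (single , _) = <⇒≱ 2≤ck (single k)

zeck-has-no-move : IsZeck c → ¬ Move c c'
zeck-has-no-move zeck           (split1 2≤c0)           = 2≤⇒¬IsZeck 0 2≤c0 zeck
zeck-has-no-move zeck           (split2 2≤c1)           = 2≤⇒¬IsZeck 1 2≤c1 zeck
zeck-has-no-move zeck           (splitHi m 2≤ck)        = 2≤⇒¬IsZeck (suc (suc m)) 2≤ck zeck
zeck-has-no-move (_ , adjacent) (combine k 1≤ck 1≤ck+1) = <⇒≱ (+-mono-≤ 1≤ck 1≤ck+1) (adjacent k)

zeck? : SupportBelow N c → Dec (IsZeck c)
zeck? supp with zeck-or-move supp
... | inj₁ zeck      = yes zeck
... | inj₂ (_ , mv)  = no λ zeck → zeck-has-no-move zeck mv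

module _ {Good Bad : State → Set} (c : State) (supp : SupportBelow N c)
         (classify : ∀ {c'} → Move c c' → Good c' ⊎ Bad c') where

  private
    GoodMove : Set
    GoodMove = Σ[ c' ∈ State ] Move c c' × Good c'

    try : ∀ {P : Set} {c'} → Dec P → (P → Move c c') → GoodMove ⊎ (P → Bad c')
    try (no ¬p) mv = inj₂ λ p → contradiction p ¬p
    try (yes p) mv with classify (mv p)
    ... | inj₁ good = inj₁ (_ , mv p , good)
    ... | inj₂ bad  = inj₂ λ _ → bad

  good-move-or-all-bad : GoodMove ⊎ (∀ {c'} → Move c c' → Bad c')
  good-move-or-all-bad
    with witness-or-all< N (λ k → try (1 ≤? c k ×-dec 1 ≤? c (suc k)) λ (h , h') → combine k h h')
       | witness-or-all< N (λ k → try (2 ≤? c k) (split k))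
  ... | inj₁ good | _         = inj₁ good
  ... | inj₂ _    | inj₁ good = inj₁ good
  ... | inj₂ combines-bad | inj₂ splits-bad = inj₂ all-bad
    where
    split-bad : ∀ k (2≤ck : 2 ≤ c k) → Bad (splitTarget k c)
    split-bad k 2≤ck = splits-bad k (support-bound supp (<⇒≤ 2≤ck)) 2≤ck
    all-bad : ∀ {c'} → Move c c' → Bad c'
    all-bad (combine k h h') = combines-bad k (support-bound supp h) (h , h')
    all-bad (split1 h)       = split-bad 0 h
    all-bad (split2 h)       = split-bad 1 h
    all-bad (splitHi m h)    = split-bad (suc (suc m)) h

-- Determinacy and delayed copying

∁-involutive : ∀ {m} (B : Subset m) → ∁ (∁ B) ≡ B
∁-involutive []      = refl
∁-involutive (x ∷ B) = cong₂ _∷_ (not-involutive x) (∁-involutive B)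

module _ (p : ℕ) .{{_ : NonZero p}} where

  InA? : ∀ B t → Dec (InA p B t)
  InA? B t = fromℕ< (m%n<n t p) ∈? B

  Secured : Subset p → ℕ → State → Set
  Secured B t c = IsZeck c ⊎ (¬ IsZeck c × Wins p B t c)

  Wins-cong : ∀ {B t} → c ≗ d → Wins p B t c → Wins p B t d
  Wins-cong c≗d (ally c' t∈B mv (inj₁ zeck)) with move-cong c≗d mv
  ... | d' , mv' , c'≗d' = ally d' t∈B mv' (inj₁ (zeck-cong c'≗d' zeck))
  Wins-cong c≗d (ally c' t∈B mv (inj₂ (¬zeck , wins))) with move-cong c≗d mv
  ... | d' , mv' , c'≗d' = ally d' t∈B mv' (inj₂ (¬zeck ∘ zeck-cong (sym ∘ c'≗d') , Wins-cong c'≗d' wins))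
  Wins-cong c≗d (foe t∉B replies) = foe t∉B λ d' mv' →
    let (c' , mv , d'≗c') = move-cong (sym ∘ c≗d) mv'
        (¬zeck , wins)    = replies c' mv
    in ¬zeck ∘ zeck-cong d'≗c' , Wins-cong (sym ∘ d'≗c') wins

  module _ {n : ℕ} where

    determined-within : ∀ fuel B t c → IsPosition n c → 3 ^ n * n < potential n c + fuel →
                        Wins p B t c ⊎ Wins p (∁ B) t c
    determined-within zero B t c pos bound =
      contradiction (≤-trans (≤-reflexive (+-identityʳ _)) (potential-bound n pos)) (<⇒≱ bound)
    determined-within (suc fuel) B t c pos bound = by-mover (InA? B t)
      where
      bound-after : Move c c' → 3 ^ n * n < potential n c' + fuel
      bound-after mv = ≤-trans bound (≤-trans (≤-reflexive (+-suc _ fuel)) (+-monoˡ-≤ fuel (move-potential pos mv)))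
      classify : ∀ B → Move c c' → Secured B (suc t) c' ⊎ (¬ IsZeck c' × Wins p (∁ B) (suc t) c')
      classify B mv with zeck? (proj₁ (move-position pos mv))
      ... | yes zeck = inj₁ (inj₁ zeck)
      ... | no ¬zeck = Sum.map (λ wins → inj₂ (¬zeck , wins)) (¬zeck ,_)
                               (determined-within fuel B (suc t) _ (move-position pos mv) (bound-after mv))
      mover-decides : ∀ B → InA p B t → Wins p B t c ⊎ Wins p (∁ B) t c
      mover-decides B t∈B with good-move-or-all-bad c (proj₁ pos) (classify B)
      ... | inj₁ (c' , mv , secured) = inj₁ (ally c' t∈B mv secured)
      ... | inj₂ all-bad             = inj₂ (foe (x∈p⇒x∉∁p t∈B) λ _ → all-bad)
      by-mover : Dec (InA p B t) → Wins p B t c ⊎ Wins p (∁ B) t c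
      by-mover (yes t∈B) = mover-decides B t∈B
      by-mover (no t∉B)  = Sum.swap (Sum.map₂ (subst (λ B′ → Wins p B′ t c) (∁-involutive B))
                                              (mover-decides (∁ B) (x∉p⇒x∈∁p t∉B)))

    determined : ∀ B t → IsPosition n c → Wins p B t c ⊎ Wins p (∁ B) t c
    determined {c} B t pos = determined-within (suc (3 ^ n * n)) B t c pos (m≤n+m _ (potential n c))

    delayed-copy : ∀ {A B t} b → (∀ i → InA p B i → InA p A (i + b)) →
                   IsPosition n c → ¬ IsZeck c → Wins p B t c → Wins p A (t + b) c
    delayed-copy b B⇒A pos ¬zeck (ally c' t∈B mv (inj₁ zeck)) = ally c' (B⇒A _ t∈B) mv (inj₁ zeck)
    delayed-copy b B⇒A pos ¬zeck (ally c' t∈B mv (inj₂ (¬zeck' , wins))) =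
      ally c' (B⇒A _ t∈B) mv (inj₂ (¬zeck' , delayed-copy b B⇒A (move-position pos mv) ¬zeck' wins))
    delayed-copy {c = c} {A = A} {t = t} b B⇒A pos ¬zeck (foe t∉B replies) = respond (InA? A (t + b))
      where
      copy : Move c c' → ¬ IsZeck c' × Wins p A (suc t + b) c'
      copy mv = let ¬zeck' , wins = replies _ mv in ¬zeck' , delayed-copy b B⇒A (move-position pos mv) ¬zeck' wins
      respond : Dec (InA p A (t + b)) → Wins p A (t + b) c
      respond (no t+b∉A)  = foe t+b∉A λ _ → copy
      respond (yes t+b∈A) with zeck-or-move (proj₁ pos)
      ... | inj₁ zeck      = contradiction zeck ¬zeck
      ... | inj₂ (c' , mv) = ally c' t+b∈A mv (inj₂ (copy mv))

-- Counting the alliance's turns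

indicator : ∀ {m} → Subset m → ℕ → ℕ
indicator []            i       = 0
indicator (x ∷ B)       (suc i) = indicator B i
indicator (inside ∷ B)  zero    = 1
indicator (outside ∷ B) zero    = 0

indicator-∈ : ∀ {m} (B : Subset m) {i} (i<m : i < m) → fromℕ< i<m ∈ₛ B → indicator B i ≡ 1
indicator-∈ (inside ∷ B) {zero}  i<m   _           = refl
indicator-∈ (x ∷ B)      {suc i} 1+i<m (there i∈B) = indicator-∈ B (s<s⁻¹ 1+i<m) i∈B

indicator-∉ : ∀ {m} (B : Subset m) {i} (i<m : i < m) → ¬ fromℕ< i<m ∈ₛ B → indicator B i ≡ 0
indicator-∉ (inside ∷ B)  {zero}  i<m   i∉B = contradiction here i∉B
indicator-∉ (outside ∷ B) {zero}  i<m   i∉B = refl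
indicator-∉ (x ∷ B)       {suc i} 1+i<m i∉B = indicator-∉ B (s<s⁻¹ 1+i<m) (i∉B ∘ there)

window : (ℕ → ℕ) → ℕ → ℕ → ℕ
window f u zero    = 0
window f u (suc L) = f u + window f (suc u) L

window-suc : ∀ f u L → window f (suc u) L ≡ window (f ∘ suc) u L
window-suc f u zero    = refl
window-suc f u (suc L) = cong (f (suc u) +_) (window-suc f (suc u) L)

window-cong : ∀ {f g} L → (∀ j → j < L → f j ≡ g j) → window f 0 L ≡ window g 0 L
window-cong {f} {g} zero    f≡g = refl
window-cong {f} {g} (suc L) f≡g = begin
  f 0 + window f 1 L         ≡⟨ cong₂ _+_ (f≡g 0 z<s) (window-suc f 0 L) ⟩
  g 0 + window (f ∘ suc) 0 L ≡⟨ cong (g 0 +_) (window-cong L (λ j j<L → f≡g (suc j) (s<s j<L))) ⟩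
  g 0 + window (g ∘ suc) 0 L ≡⟨ cong (g 0 +_) (window-suc g 0 L) ⟨
  g 0 + window g 1 L         ∎
  where open ≡-Reasoning

window-+ : ∀ f u m L → window f u (m + L) ≡ window f u m + window f (u + m) L
window-+ f u zero    L = cong (λ v → window f v L) (sym (+-identityʳ u))
window-+ f u (suc m) L = begin
  f u + window f (suc u) (m + L)                      ≡⟨ cong (f u +_) (window-+ f (suc u) m L) ⟩
  f u + (window f (suc u) m + window f (suc u + m) L) ≡⟨ +-assoc (f u) _ _ ⟨
  f u + window f (suc u) m + window f (suc u + m) L   ≡⟨ cong (λ v → window f u (suc m) + window f v L) (sym (+-suc u m)) ⟩
  window f u (suc m) + window f (u + suc m) L         ∎
  where open ≡-Reasoning

window-periodic : ∀ f p → (∀ t → f (t + p) ≡ f t) → ∀ u → window f u p ≡ window f 0 p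
window-periodic f p f-periodic zero    = refl
window-periodic f p f-periodic (suc u) = trans (+-cancelˡ-≡ (f u) _ _ shift) (window-periodic f p f-periodic u)
  where
  open ≡-Reasoning
  shift : f u + window f (suc u) p ≡ f u + window f u p
  shift = begin
    window f u (suc p)                ≡⟨ cong (window f u) (+-comm 1 p) ⟩
    window f u (p + 1)                ≡⟨ window-+ f u p 1 ⟩
    window f u p + (f (u + p) + 0)    ≡⟨ cong (window f u p +_) (trans (+-identityʳ _) (f-periodic u)) ⟩
    window f u p + f u                ≡⟨ +-comm (window f u p) (f u) ⟩
    f u + window f u p                ∎

window-indicator : ∀ {m} (B : Subset m) → window (indicator B) 0 m ≡ ∣ B ∣
window-indicator []                = refl
window-indicator {suc m} (inside ∷ B)  = cong suc (trans (window-suc (indicator (inside ∷ B)) 0 m) (window-indicator B))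
window-indicator {suc m} (outside ∷ B) = trans (window-suc (indicator (outside ∷ B)) 0 m) (window-indicator B)

-- The strategy

2+[2L+x]≡2[1+L]+x : ∀ L x → 2 + (2 * L + x) ≡ 2 * suc L + x
2+[2L+x]≡2[1+L]+x = solve-∀

losses-add : ∀ L {x y z} → x ≤ 2 + y → y ≤ 2 * L + z → x ≤ 2 * suc L + z
losses-add L {z = z} x≤2+y y≤2L+z =
  ≤-trans x≤2+y (≤-trans (+-monoʳ-≤ 2 y≤2L+z) (≤-reflexive (2+[2L+x]≡2[1+L]+x L z)))

gains-add : ∀ L i a {x y z} → 3 * i + x ≤ 2 + y → 3 * a + y ≤ 2 * L + z → 3 * (i + a) + x ≤ 2 * suc L + z
gains-add L i a {x} {y} {z} first rest = begin
  3 * (i + a) + x     ≡⟨ regroup i a x ⟩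
  3 * a + (3 * i + x) ≤⟨ +-monoʳ-≤ (3 * a) first ⟩
  3 * a + (2 + y)     ≡⟨ x∙yz≈y∙xz (3 * a) 2 y ⟩
  2 + (3 * a + y)     ≤⟨ +-monoʳ-≤ 2 rest ⟩
  2 + (2 * L + z)     ≡⟨ 2+[2L+x]≡2[1+L]+x L z ⟩
  2 * suc L + z       ∎
  where
  open ≤-Reasoning
  regroup : ∀ i a x → 3 * (i + a) + x ≡ 3 * a + (3 * i + x)
  regroup = solve-∀

combine₀ split₀₁ : State → State
combine₀ c = bump 2 (drop 1 (drop 0 c))
split₀₁ c = splitTarget 1 (splitTarget 0 c)

combine₀-cong : c ≗ d → combine₀ c ≗ combine₀ d
combine₀-cong c≗d = bump-cong 2 (drop-cong 1 (drop-cong 0 c≗d))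

combine₀≗split₀₁ : 2 ≤ c 0 → combine₀ c ≗ split₀₁ c
combine₀≗split₀₁ {c} 2≤c0 zero = trans (sym (m∸n+n≡m {c 0 ∸ 1} {1} (∸-monoˡ-≤ 1 2≤c0))) (+-comm _ 1)
combine₀≗split₀₁ 2≤c0 (suc zero)          = refl
combine₀≗split₀₁ 2≤c0 (suc (suc zero))    = refl
combine₀≗split₀₁ 2≤c0 (suc (suc (suc j))) = refl

combine₀-at-0 : ∀ j c → iterate combine₀ c j 0 ≡ c 0 ∸ j
combine₀-at-0 zero    c = refl
combine₀-at-0 (suc j) c = trans (combine₀-at-0 j (combine₀ c)) (∸-+-assoc (c 0) 1 j)

iterate-combine₀≗split₀₁ : ∀ j c → suc j ≤ c 0 → iterate combine₀ c j ≗ iterate split₀₁ c j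
iterate-combine₀≗split₀₁ zero    c _      = λ _ → refl
iterate-combine₀≗split₀₁ (suc j) c 2+j≤c0 i = begin
  iterate combine₀ (combine₀ c) j i ≡⟨ iterate-cong j (combine₀≗split₀₁ (≤-trans (s≤s (s≤s z≤n)) 2+j≤c0)) i ⟩
  iterate combine₀ (split₀₁ c) j i  ≡⟨ iterate-combine₀≗split₀₁ j (split₀₁ c) (s≤s (∸-monoˡ-≤ 1 (∸-monoˡ-≤ 1 2+j≤c0))) i ⟩
  iterate split₀₁ (split₀₁ c) j i   ∎
  where
  open ≡-Reasoning
  iterate-cong : ∀ {x y} j → x ≗ y → iterate combine₀ x j ≗ iterate combine₀ y j
  iterate-cong zero    x≗y = x≗y
  iterate-cong (suc j) x≗y = iterate-cong j (combine₀-cong x≗y)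

data Run : ℕ → State → State → Set where
  []   : Run 0 c c
  step : ∀ {j} → Move c c' → ¬ IsZeck c' → Run j c' d → Run (suc j) c d

run-position : ∀ {n j} → IsPosition n c → Run j c d → IsPosition n d
run-position pos []              = pos
run-position pos (step mv _ run) = run-position (move-position pos mv) run

combine-run : ∀ j c → 2 + j ≤ c 0 → j ≤ c 1 → Run j c (iterate combine₀ c j)
combine-run zero    c _     _     = []
combine-run (suc j) c h₀ h₁ =
  step (combine 0 (≤-trans (s≤s z≤n) h₀) (≤-trans (s≤s z≤n) h₁)) (2≤⇒¬IsZeck 0 (≤-trans (s≤s (s≤s z≤n)) h₀′))
       (combine-run j (combine₀ c) h₀′ (∸-monoˡ-≤ 1 h₁))
  where
  h₀′ : 2 + j ≤ c 0 ∸ 1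
  h₀′ = ∸-monoˡ-≤ 1 h₀

split-run : ∀ j c → 2 + j ≤ c 0 → j ≤ c 1 → Run (2 * j) c (iterate split₀₁ c j)
split-run zero    c _  _  = []
split-run (suc j) c h₀ h₁ = subst (λ k → Run k c (iterate split₀₁ c (suc j))) (sym (*-suc 2 j))
  (step (split1 (≤-trans (s≤s (s≤s z≤n)) h₀)) (2≤⇒¬IsZeck 1 2≤c1+1)
  (step (split2 2≤c1+1) (2≤⇒¬IsZeck 0 (≤-trans (s≤s (s≤s z≤n)) h₀′))
  (split-run j (split₀₁ c) h₀′ (∸-monoˡ-≤ 1 h₁))))
  where
  h₀′ : 2 + j ≤ split₀₁ c 0
  h₀′ = s≤s (∸-monoˡ-≤ 1 (∸-monoˡ-≤ 1 h₀))
  2≤c1+1 : 2 ≤ suc (c 1)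
  2≤c1+1 = s≤s (≤-trans (s≤s z≤n) h₁)

module Alliance (p : ℕ) .{{_ : NonZero p}} (A : Subset p) (n : ℕ) where

  InA-mod : ∀ {t t'} → t % p ≡ t' % p → InA p A t → InA p A t'
  InA-mod {t} {t'} t≡t' = subst (_∈ₛ A) (fromℕ<-cong _ _ t≡t' (m%n<n t p) (m%n<n t' p))

  isAlly : ℕ → ℕ
  isAlly t = indicator A (t % p)

  allyTurns : ℕ → ℕ → ℕ
  allyTurns = window isAlly

  allyTurns-per-period : ∀ u → allyTurns u p ≡ ∣ A ∣
  allyTurns-per-period u = begin
    window isAlly u p        ≡⟨ window-periodic isAlly p (λ t → cong (indicator A) ([m+n]%n≡m%n t p)) u ⟩
    window isAlly 0 p        ≡⟨ window-cong p (λ j j<p → cong (indicator A) (m<n⇒m%n≡m j<p)) ⟩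
    window (indicator A) 0 p ≡⟨ window-indicator A ⟩
    ∣ A ∣                    ∎
    where open ≡-Reasoning

  allyTurns-periods : ∀ k u → allyTurns u (k * p) ≡ k * ∣ A ∣
  allyTurns-periods zero    u = refl
  allyTurns-periods (suc k) u =
    trans (window-+ isAlly u p (k * p)) (cong₂ _+_ (allyTurns-per-period u) (allyTurns-periods k (u + p)))

  phase : ∀ L u c → IsPosition n c → 2 * L + 2 ≤ c 0 →
          (∀ c' → IsPosition n c' → c 0 ≤ 2 * L + c' 0 → 3 * allyTurns u L + c 1 ≤ 2 * L + c' 1 →
                  Wins p A (u + L) c') →
          Wins p A u c
  phase zero    u c pos _     continue = subst (λ t → Wins p A t c) (+-identityʳ u) (continue c pos ≤-refl ≤-refl)
  phase (suc L) u c pos bound continue = turn (InA? p A u)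
    where
    next : Move c c' → c 0 ≤ 2 + c' 0 → 3 * isAlly u + c 1 ≤ 2 + c' 1 → ¬ IsZeck c' × Wins p A (suc u) c'
    next {c'} mv loss gain = ¬zeck , phase L (suc u) c' (move-position pos mv) bound' continue'
      where
      open ≤-Reasoning
      bound' : 2 * L + 2 ≤ c' 0
      bound' = +-cancelˡ-≤ 2 _ _ (begin
        2 + (2 * L + 2) ≡⟨ 2+[2L+x]≡2[1+L]+x L 2 ⟩
        2 * suc L + 2   ≤⟨ bound ⟩
        c 0             ≤⟨ loss ⟩
        2 + c' 0        ∎)
      ¬zeck : ¬ IsZeck c'
      ¬zeck = 2≤⇒¬IsZeck 0 (≤-trans (m≤n+m 2 (2 * L)) bound')
      continue' : ∀ c'' → IsPosition n c'' → c' 0 ≤ 2 * L + c'' 0 → 3 * allyTurns (suc u) L + c' 1 ≤ 2 * L + c'' 1 →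
                  Wins p A (suc u + L) c''
      continue' c'' pos'' loss' gain' = subst (λ t → Wins p A t c'') (+-suc u L)
        (continue c'' pos'' (losses-add L loss loss') (gains-add L (isAlly u) (allyTurns (suc u) L) gain gain'))
    2≤c0 : 2 ≤ c 0
    2≤c0 = ≤-trans (m≤n+m 2 (2 * suc L)) bound
    turn : Dec (InA p A u) → Wins p A u c
    turn (yes u∈A) = ally _ u∈A (split1 2≤c0) (inj₂ (next (split1 2≤c0) loss gain))
      where
      loss : c 0 ≤ 2 + (c 0 ∸ 1 ∸ 1)
      loss = subst (λ x → c 0 ≤ 2 + x) (sym (∸-+-assoc (c 0) 1 1)) (m≤n+m∸n (c 0) 2)
      gain : 3 * isAlly u + c 1 ≤ 2 + suc (c 1)
      gain = ≤-reflexive (trans (cong (λ x → 3 * x + c 1) (indicator-∈ A (m%n<n u p) u∈A)) (sym (+-suc 2 (c 1))))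
    turn (no u∉A) = foe u∉A λ c' mv →
      next mv (move-loss mv 0) (subst (λ x → 3 * x + c 1 ≤ 2 + c' 1) (sym (indicator-∉ A (m%n<n u p) u∉A)) (move-loss mv 1))

  follow : ∀ {j t c d} → Run j c d → (∀ i → i < j → InA p A (t + i)) → Wins p A (t + j) d → Wins p A t c
  follow {t = t} {c} [] _ wins = subst (λ t′ → Wins p A t′ c) (+-identityʳ t) wins
  follow {t = t} {d = d} (step mv ¬zeck run) turns wins =
    ally _ (subst (InA p A) (+-identityʳ t) (turns 0 z<s)) mv
      (inj₂ (¬zeck , follow run (λ i i<j → subst (InA p A) (+-suc t i) (turns (suc i) (s<s i<j)))
                                (subst (λ t′ → Wins p A t′ d) (+-suc t _) wins)))

  block : ∀ b T c → (∀ i → ¬ InA p A (i + b) → InA p A i) → (∀ i → i < 2 * b → InA p A (T + i)) →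
          IsPosition n c → 2 + b ≤ c 0 → b ≤ c 1 → Wins p A T c
  block b T c exchange turns pos h₀ h₁ = conclude (determined p A (T + b) (run-position pos combines))
    where
    combines : Run b c (iterate combine₀ c b)
    combines = combine-run b c h₀ h₁
    ∁A⇒A : ∀ i → InA p (∁ A) i → InA p A (i + b)
    ∁A⇒A i i∈∁A with InA? p A (i + b)
    ... | yes i+b∈A = i+b∈A
    ... | no i+b∉A  = contradiction (exchange i i+b∉A) (x∈∁p⇒x∉p i∈∁A)
    ¬zeck : ¬ IsZeck (iterate combine₀ c b)
    ¬zeck = 2≤⇒¬IsZeck 0 (subst (2 ≤_) (sym (combine₀-at-0 b c)) (m+n≤o⇒m≤o∸n 2 h₀))
    T+b+b≡T+2b : T + b + b ≡ T + 2 * b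
    T+b+b≡T+2b = trans (+-assoc T b b) (cong (λ x → T + (b + x)) (sym (+-identityʳ b)))
    conclude : Wins p A (T + b) (iterate combine₀ c b) ⊎ Wins p (∁ A) (T + b) (iterate combine₀ c b) → Wins p A T c
    conclude (inj₁ wins)  = follow combines (λ i i<b → turns i (≤-trans i<b (m≤m+n b (b + 0)))) wins
    conclude (inj₂ loses) = follow (split-run b c h₀ h₁) turns
      (subst (λ t → Wins p A t (iterate split₀₁ c b)) T+b+b≡T+2b
        (Wins-cong p (iterate-combine₀≗split₀₁ b c (≤-trans (n≤1+n _) h₀))
          (delayed-copy p b ∁A⇒A (run-position pos combines) ¬zeck loses)))

  twos-after-rounds : ∀ b u {x y} → 2 * p < 3 * ∣ A ∣ → 3 * allyTurns u (b * p) + x ≤ 2 * (b * p) + y → b ≤ y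
  twos-after-rounds b u {x} {y} majority gains = +-cancelˡ-≤ (2 * (b * p)) _ _ (begin
    2 * (b * p) + b                ≡⟨ expand b p ⟩
    b * suc (2 * p)                ≤⟨ *-monoʳ-≤ b majority ⟩
    b * (3 * ∣ A ∣)                ≡⟨ reorder b ∣ A ∣ ⟩
    3 * (b * ∣ A ∣)                ≡⟨ cong (3 *_) (allyTurns-periods b u) ⟨
    3 * allyTurns u (b * p)        ≤⟨ m≤m+n _ x ⟩
    3 * allyTurns u (b * p) + x    ≤⟨ gains ⟩
    2 * (b * p) + y                ∎)
    where
    open ≤-Reasoning
    expand : ∀ b p → 2 * (b * p) + b ≡ b * suc (2 * p)
    expand = solve-∀
    reorder : ∀ b a → b * (3 * a) ≡ 3 * (b * a)
    reorder = solve-∀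

  InA-translate : ∀ s b i → InA p A (s + i) → InA p A (s % p + b * p + i)
  InA-translate s b i = InA-mod (begin
    (s + i) % p                   ≡⟨ %-distribˡ-+ s i p ⟩
    (s % p + i % p) % p           ≡⟨ cong (λ x → (x + i % p) % p) (m%n%n≡m%n s p) ⟨
    (s % p % p + i % p) % p       ≡⟨ %-distribˡ-+ (s % p) i p ⟨
    (s % p + i) % p               ≡⟨ [m+kn]%n≡m%n (s % p + i) b p ⟨
    (s % p + i + b * p) % p       ≡⟨ cong (_% p) (xy∙z≈xz∙y (s % p) i (b * p)) ⟩
    (s % p + b * p + i) % p       ∎)
    where open ≡-Reasoning

  wins-from-start : ∀ b s → (∀ i → ¬ InA p A (i + b) → InA p A i) → (∀ i → i < 2 * b → InA p A (s + i)) →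
                    2 * p < 3 * ∣ A ∣ → 2 * (p + b * p) + b ≤ n → HasWinningStrategy p A n
  wins-from-start b s exchange turns majority enough =
    phase s₀ 0 (start n) (start-position n) bound₁ λ c pos loss₁ _ →
    phase (b * p) s₀ c pos (bound₂ c loss₁) λ c′ pos′ loss₂ gain₂ →
    block b (s₀ + b * p) c′ exchange (λ i i<2b → InA-translate s b i (turns i i<2b)) pos′
          (surplus₀ c c′ loss₁ loss₂) (twos-after-rounds b s₀ majority gain₂)
    where
    open ≤-Reasoning hiding (start)
    s₀ : ℕ
    s₀ = s % p
    enough′ : 2 * s₀ + (2 * (b * p) + (2 + b)) ≤ n
    enough′ = begin
      2 * s₀ + (2 * (b * p) + (2 + b)) ≡⟨ regroup s₀ (b * p) b ⟩
      2 * suc s₀ + 2 * (b * p) + b     ≤⟨ +-monoˡ-≤ b (+-monoˡ-≤ (2 * (b * p)) (*-monoʳ-≤ 2 (m%n<n s p))) ⟩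
      2 * p + 2 * (b * p) + b          ≡⟨ cong (_+ b) (*-distribˡ-+ 2 p (b * p)) ⟨
      2 * (p + b * p) + b              ≤⟨ enough ⟩
      n                                ∎
      where
      regroup : ∀ s x b → 2 * s + (2 * x + (2 + b)) ≡ 2 * suc s + 2 * x + b
      regroup = solve-∀
    bound₁ : 2 * s₀ + 2 ≤ n
    bound₁ = ≤-trans (+-monoʳ-≤ (2 * s₀) (≤-trans (m≤m+n 2 b) (m≤n+m (2 + b) (2 * (b * p))))) enough′
    bound₂ : ∀ c → n ≤ 2 * s₀ + c 0 → 2 * (b * p) + 2 ≤ c 0
    bound₂ c loss₁ = +-cancelˡ-≤ (2 * s₀) _ _
      (≤-trans (+-monoʳ-≤ (2 * s₀) (+-monoʳ-≤ (2 * (b * p)) (m≤m+n 2 b))) (≤-trans enough′ loss₁))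
    surplus₀ : ∀ c c′ → n ≤ 2 * s₀ + c 0 → c 0 ≤ 2 * (b * p) + c′ 0 → 2 + b ≤ c′ 0
    surplus₀ c c′ loss₁ loss₂ = +-cancelˡ-≤ (2 * (b * p)) _ _ (+-cancelˡ-≤ (2 * s₀) _ _
      (≤-trans enough′ (≤-trans loss₁ (+-monoʳ-≤ (2 * s₀) loss₂))))

theorem1p3p5 : (p : ℕ) .{{_ : NonZero p}} (A : Subset p) (b n : ℕ) →
    2 * p < 3 * ∣ A ∣ →
    (∀ i → ¬ InA p A (i + b) → InA p A i) →
    (∃ λ s → ∀ j → j < 2 * b → InA p A (s + j)) →
    4 * p * b + 2 * p ∸ 2 * b ≤ n →
    HasWinningStrategy p A n
-- For p = 1 the bound needed by wins-from-start can fail, but then A is everybody and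
-- wins-from-start applies with b = 0.
theorem1p3p5 (suc zero) (outside ∷ []) b n () _ _ _
theorem1p3p5 (suc zero) (inside ∷ []) b n majority _ _ enough =
  Alliance.wins-from-start 1 (inside ∷ []) n 0 0 (λ i _ → everyone _) (λ _ ()) majority (≤-trans 2≤bound enough)
  where
  everyone : (x : Fin 1) → x ∈ₛ (inside ∷ [])
  everyone zero = here
  2≤bound : 2 ≤ 4 * 1 * b + 2 * 1 ∸ 2 * b
  2≤bound = m+n≤o⇒m≤o∸n 2 (≤-trans (m≤m+n (2 + 2 * b) (2 * b)) (≤-reflexive (split-bound b)))
    where
    split-bound : ∀ b → 2 + 2 * b + 2 * b ≡ 4 * 1 * b + 2 * 1
    split-bound = solve-∀
theorem1p3p5 p@(suc (suc q)) A b n majority exchange (s , turns) enough =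
  Alliance.wins-from-start p A n b s exchange turns majority (≤-trans needed enough)
  where
  needed : 2 * (p + b * p) + b ≤ 4 * p * b + 2 * p ∸ 2 * b
  needed = m+n≤o⇒m≤o∸n _ (≤-trans (m≤m+n _ (2 * q * b + b)) (≤-reflexive (split-bound q b)))
    where
    split-bound : ∀ q b → 2 * (suc (suc q) + b * suc (suc q)) + b + 2 * b + (2 * q * b + b) ≡ 4 * suc (suc q) * b + 2 * suc (suc q)
    split-bound = solve-∀
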